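{- Let $p,q$ be secondary colors and let $\Delta(p,q)$ be the least integer $d$ such that $k_p\gg(k-d)_q$ (this does not depend on $k$). Then: (i) $\Delta(p,q)=\min\{k-l:\ k,l\ge2,\ \beta(k_p)\succ\alpha(l_q)\}$; (ii) for secondary parts $k_p,l_q\in\mathcal{S}$ with $\beta(k_p)\succ\beta(l_q)$, we have $(k+1)_p\gg l_q$; (iii) for $k_p,l_q\in\mathcal{S}$ with $k-l\ge\Delta(p,q)$, either $\beta(k_p)\succ\alpha(l_q)$ or $\alpha(l_q)+1\gg\alpha((k-1)_p)\succ\beta((k-1)_p)\succ\beta(l_q)$; (iv) if moreover $k-l=\Delta(p,q)$ then $\beta(l_q)+1\succeq\beta(k_p)$, while if $k-l>\Delta(p,q)$ then $\beta(k_p)\succ\alpha(l_q)$.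
   Context: Primary colors $a_1<\cdots<a_n$; secondary colors $a_ia_j$ ($i<j$); total order $a_1a_2<\cdots<a_1a_n<a_1<a_2a_3<\cdots<a_2a_n<a_2<\cdots<a_{n-1}a_n<a_{n-1}<a_n$. A part $k_p$ has integer size $k$ and color $p$; for an integer $m$, $k_p+m=(k+m)_p$. $k_p\succ l_q$ iff $k-l\ge\chi(p\le q)$; $\succeq$ means $\succ$ or equal. Special pairs: $(a_ka_l,a_ia_j)$ with $i<j<k<l$ or $k<i<j<l$. $\mathcal{S}$: parts with secondary color and size $\ge2$. The relation $\gg$: $k_p\gg l_q$ iff $k_p\succeq(l+1)_q$ when $p$ or $q$ is primary; $k_p\succ(l+1)_q$ when both are secondary and $(p,q)$ not special; $k_p\succ l_q$ when $(p,q)$ is special. Halves (for $k\ge0$): $\alpha((2k)_{a_ia_j})=k_{a_j}$, $\beta((2k)_{a_ia_j})=k_{a_i}$, $\alpha((2k+1)_{a_ia_j})=(k+1)_{a_i}$, $\beta((2k+1)_{a_ia_j})=k_{a_j}$. -}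

module Defs where

open import Data.Nat as ℕ using (ℕ; _≡ᵇ_; _<ᵇ_; _≤ᵇ_)
open import Data.Integer as ℤ using (ℤ; +_; _+_; _-_)
open import Data.Fin using (Fin; toℕ; _<_)
open import Data.Bool using (Bool; true; false; _∧_; _∨_)
open import Data.Product using (Σ; _×_; _,_)
open import Data.Sum using (_⊎_)
open import Relation.Nullary using (¬_)
open import Relation.Binary.PropositionalEquality using (_≡_)

-- Secondary color a_i a_j with i < j (indices in Fin n, i.e. a_1..a_n ↦ 0..n-1).
record SecColor (n : ℕ) : Set where
  constructor _·_[_]
  field
    i : Fin n
    j : Fin n
    i<j : i < j
open SecColor public

data Color (n : ℕ) : Set where
  prim : Fin n → Color n
  sec  : SecColor n → Color n

-- Position key for the total order
-- a_1a_2 < ... < a_1a_n < a_1 < a_2a_3 < ... < a_2 < ... < a_{n-1}a_n < a_{n-1} < a_n :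
-- lexicographic on (i, j), a primary a_i getting second component n (> every j).
key₁ : ∀ {n} → Color n → ℕ
key₁ (prim i) = toℕ i
key₁ (sec s)  = toℕ (i s)

key₂ : ∀ {n} → Color n → ℕ
key₂ {n} (prim _) = n
key₂ (sec s)      = toℕ (j s)

_≤ᶜ_ : ∀ {n} → Color n → Color n → Bool
p ≤ᶜ q = (key₁ p <ᵇ key₁ q) ∨ ((key₁ p ≡ᵇ key₁ q) ∧ (key₂ p ≤ᵇ key₂ q))

χ : Bool → ℤ
χ true  = + 1
χ false = + 0

record Part (n : ℕ) : Set where
  constructor _at_
  field
    size  : ℤ
    color : Color n
open Part public

infixl 6 _+ₚ_
infix 4 _≻_ _⪰_ _≫_
_+ₚ_ : ∀ {n} → Part n → ℤ → Part n
(k at p) +ₚ m = (k + m) at p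

_≻_ : ∀ {n} → Part n → Part n → Set
(k at p) ≻ (l at q) = χ (p ≤ᶜ q) ℤ.≤ k - l

_⪰_ : ∀ {n} → Part n → Part n → Set
P ⪰ Q = P ≻ Q ⊎ P ≡ Q

Special : ∀ {n} → SecColor n → SecColor n → Set
Special (k · l [ _ ]) (i · j [ _ ]) =
  (i < j × j < k × k < l) ⊎ (k < i × i < j × j < l)

_≫_ : ∀ {n} → Part n → Part n → Set
(k at prim a) ≫ (l at q)      = (k at prim a) ⪰ ((l at q) +ₚ + 1)
(k at sec s)  ≫ (l at prim b) = (k at sec s) ⪰ ((l at prim b) +ₚ + 1)
(k at sec s)  ≫ (l at sec t)  =
  (Special s t → (k at sec s) ≻ (l at sec t))
  × (¬ Special s t → (k at sec s) ≻ ((l at sec t) +ₚ + 1))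

secPart : ∀ {n} → ℕ → SecColor n → Part n
secPart k s = (+ k) at sec s

α : ∀ {n} → ℕ → SecColor n → Part n
α k s with k ℕ.% 2
... | 0 = (+ (k ℕ./ 2)) at prim (j s)
... | _ = (+ (k ℕ./ 2 ℕ.+ 1)) at prim (i s)

β : ∀ {n} → ℕ → SecColor n → Part n
β k s with k ℕ.% 2
... | 0 = (+ (k ℕ./ 2)) at prim (i s)
... | _ = (+ (k ℕ./ 2)) at prim (j s)

IsΔ : ∀ {n} → SecColor n → SecColor n → ℤ → Set
IsΔ p q d = ∀ (k : ℤ) →
  ((k at sec p) ≫ ((k - d) at sec q))
  × (∀ (d' : ℤ) → (k at sec p) ≫ ((k - d') at sec q) → d ℤ.≤ d')

IsMinβα : ∀ {n} → SecColor n → SecColor n → ℤ → Set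
IsMinβα p q d =
  Σ ℕ (λ k → Σ ℕ (λ l → 2 ℕ.≤ k × 2 ℕ.≤ l × β k p ≻ α l q × d ≡ + k - + l))
  × (∀ (k l : ℕ) → 2 ℕ.≤ k → 2 ℕ.≤ l → β k p ≻ α l q → d ℤ.≤ + k - + l)

module Submission where

-- Write p = a_a a_b and q = a_c a_d.  The halves of a secondary part are consecutive
-- terms of one strictly increasing sequence of primary parts
--   halfSeq p = 0_{a_a}, 0_{a_b}, 1_{a_a}, 1_{a_b}, 2_{a_a}, …
-- namely β(k_p) = halfSeq p k and α(k_p) = halfSeq p (k+1).  Every claim of the lemma is
-- therefore about the comparisons  C k l := halfSeq p k ≻ halfSeq q l.  On primary parts
-- ≻ is the strict lexicographic order on (size, index); so C is monotone (larger k, smaller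
-- l) and invariant under (k, l) ↦ (k+2, l+2).
--
-- It then proves,
-- for each position, the two threshold facts: C fails on the diagonal k - l = D - 2, and on
-- the diagonal k - l = D - 1 it holds at k or at k+1 (a check at sizes 0 and 1, propagated
-- by the shift invariance).  Parts (i)-(iv) are formal consequences of these two facts,
-- monotonicity and the totality of ≻ on primary parts.

open import Defs
open import Data.Nat as ℕ using (ℕ; zero; suc; z≤n; s≤s; _≤′_; ≤′-refl; ≤′-step)
import Data.Nat.Properties as NP
open import Data.Nat.DivMod using (m*n%n≡0; m*n/n≡m; [m+kn]%n≡m%n; m/n≡1+[m∸n]/n)
open import Data.Integer as ℤ using (ℤ; +_; _-_)
import Data.Integer.Properties as ZP
import Data.Integer.Tactic.RingSolver as ZS
open import Data.Fin using (Fin; toℕ)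
import Data.Fin.Properties as FP
open import Data.Bool using (Bool; true; false; T; _∨_; _∧_)
open import Data.Unit using (tt)
open import Data.Product using (Σ; _×_; _,_; proj₁; proj₂)
open import Data.Sum using (_⊎_; inj₁; inj₂; map; [_,_]′)
open import Data.Empty using (⊥-elim)
open import Function using (_∘_)
open import Relation.Nullary using (¬_; yes; no)
open import Relation.Binary.Definitions using (tri<; tri≈; tri>)
open import Relation.Binary.PropositionalEquality

minus-plus : ∀ (x y : ℤ) → (x - y) ℤ.+ y ≡ x
minus-plus = ZS.solve-∀

plus-minus : ∀ (x y : ℤ) → (x ℤ.+ y) - y ≡ x
plus-minus = ZS.solve-∀

≤-minus→ : ∀ {c m m' : ℤ} → c ℤ.≤ m - m' → c ℤ.+ m' ℤ.≤ m
≤-minus→ {c} {m} {m'} h = subst (c ℤ.+ m' ℤ.≤_) (minus-plus m m') (ZP.+-monoˡ-≤ m' h)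

≤-minus← : ∀ {c m m' : ℤ} → c ℤ.+ m' ℤ.≤ m → c ℤ.≤ m - m'
≤-minus← {c} {m} {m'} h = subst (ℤ._≤ m - m') (plus-minus c m') (ZP.+-monoˡ-≤ (ℤ.- m') h)

ℕ-minus→ : ∀ {c m m' : ℕ} → + c ℤ.≤ + m - + m' → c ℕ.+ m' ℕ.≤ m
ℕ-minus→ {m' = m'} h = ZP.drop‿+≤+ (≤-minus→ {m' = + m'} h)

ℕ-minus← : ∀ {c m m' : ℕ} → c ℕ.+ m' ℕ.≤ m → + c ℤ.≤ + m - + m'
ℕ-minus← {m' = m'} h = ≤-minus← {m' = + m'} (ℤ.+≤+ h)

ℕ-minus-≡ : ∀ {c m m' : ℕ} → + m - + m' ≡ + c → c ℕ.+ m' ≡ m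
ℕ-minus-≡ {c} {m} {m'} e =
  cong ℤ.∣_∣ (trans (cong (ℤ._+ + m') (sym e)) (minus-plus (+ m) (+ m')))

ℕ-minus-< : ∀ {c m m' : ℕ} → + c ℤ.< + m - + m' → suc c ℕ.+ m' ℕ.≤ m
ℕ-minus-< {m' = m'} h = ℕ-minus→ {m' = m'} (ZP.i<j⇒suc[i]≤j h)

regroup : ∀ (x y : ℤ) → x ℤ.+ (y ℤ.+ + 1) ≡ (x ℤ.+ + 1) ℤ.+ y
regroup = ZS.solve-∀

K-[K-d] : ∀ (K d : ℤ) → K - (K - d) ≡ d
K-[K-d] = ZS.solve-∀

module Lex (x y x' y' : ℕ) where
  lex : Bool
  lex = (x ℕ.<ᵇ y) ∨ ((x ℕ.≡ᵇ y) ∧ (x' ℕ.≤ᵇ y'))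

  lex-< : x ℕ.< y → lex ≡ true
  lex-< lt with x ℕ.<ᵇ y | NP.<⇒<ᵇ lt
  ... | true | _ = refl

  lex-> : y ℕ.< x → lex ≡ false
  lex-> gt with x ℕ.<ᵇ y in lt | x ℕ.≡ᵇ y in eq
  ... | false | false = refl
  ... | true  | _    = ⊥-elim (NP.<-asym gt (NP.<ᵇ⇒< x y (subst T (sym lt) tt)))
  ... | false | true = ⊥-elim (NP.<-irrefl (sym (NP.≡ᵇ⇒≡ x y (subst T (sym eq) tt))) gt)

  lex-≡ : x ≡ y → lex ≡ (x' ℕ.≤ᵇ y')
  lex-≡ refl with x ℕ.<ᵇ x in lt | x ℕ.≡ᵇ x | NP.≡⇒≡ᵇ x x refl
  ... | false | true | _ = refl
  ... | true  | _    | _ = ⊥-elim (NP.<-irrefl refl (NP.<ᵇ⇒< x x (subst T (sym lt) tt)))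

  lex-≡-≤ : x ≡ y → x' ℕ.≤ y' → lex ≡ true
  lex-≡-≤ e le = trans (lex-≡ e) (T-true (NP.≤⇒≤ᵇ le))
    where
    T-true : ∀ {b} → T b → b ≡ true
    T-true {true} _ = refl

  lex-≡-> : x ≡ y → y' ℕ.< x' → lex ≡ false
  lex-≡-> e gt with x' ℕ.≤ᵇ y' in le | lex-≡ e
  ... | false | r = r
  ... | true  | _ = ⊥-elim (NP.<⇒≱ gt (NP.≤ᵇ⇒≤ x' y' (subst T (sym le) tt)))

χ-prim-≤ : ∀ {n} (x y : Fin n) → toℕ x ℕ.≤ toℕ y → χ (prim x ≤ᶜ prim y) ≡ + 1
χ-prim-≤ {n} x y le with NP.m≤n⇒m<n∨m≡n le
... | inj₁ lt = cong χ (Lex.lex-< (toℕ x) (toℕ y) n n lt)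
... | inj₂ eq = cong χ (Lex.lex-≡-≤ (toℕ x) (toℕ y) n n eq NP.≤-refl)

χ-prim-> : ∀ {n} (x y : Fin n) → toℕ y ℕ.< toℕ x → χ (prim x ≤ᶜ prim y) ≡ + 0
χ-prim-> {n} x y gt = cong χ (Lex.lex-> (toℕ x) (toℕ y) n n gt)

χ≤1 : ∀ b → χ b ℤ.≤ + 1
χ≤1 true  = ZP.≤-refl
χ≤1 false = ℤ.+≤+ z≤n

0≤χ : ∀ b → + 0 ℤ.≤ χ b
0≤χ true  = ℤ.+≤+ z≤n
0≤χ false = ZP.≤-refl

≻-bySize : ∀ {n} (k l : ℤ) (x y : Color n) → l ℤ.< k → (k at x) ≻ (l at y)
≻-bySize k l x y lt =
  ≤-minus← {m' = l} (ZP.≤-trans (ZP.+-monoˡ-≤ l (χ≤1 (x ≤ᶜ y))) (ZP.i<j⇒suc[i]≤j lt))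

≻⇒≥ : ∀ {n} (k l : ℤ) (x y : Color n) → (k at x) ≻ (l at y) → l ℤ.≤ k
≻⇒≥ k l x y h =
  ZP.≤-trans (subst (ℤ._≤ χ (x ≤ᶜ y) ℤ.+ l) (ZP.+-identityˡ l) (ZP.+-monoˡ-≤ l (0≤χ (x ≤ᶜ y))))
             (≤-minus→ {m' = l} h)

≻-byIndex : ∀ {n} (k l : ℤ) (x y : Fin n) → toℕ y ℕ.< toℕ x → l ℤ.≤ k →
            (k at prim x) ≻ (l at prim y)
≻-byIndex k l x y gt le =
  subst (ℤ._≤ k - l) (sym (χ-prim-> x y gt))
        (≤-minus← {m' = l} (subst (ℤ._≤ k) (sym (ZP.+-identityˡ l)) le))

≻⇒> : ∀ {n} (k l : ℤ) (x y : Fin n) → (k at prim x) ≻ (l at prim y) →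
      toℕ x ℕ.≤ toℕ y → l ℤ.< k
≻⇒> k l x y h le =
  ZP.suc[i]≤j⇒i<j (≤-minus→ {m' = l} (subst (ℤ._≤ k - l) (χ-prim-≤ x y le) h))

-- So on primary parts ≻ is the strict lexicographic order on (size, index):
-- it is transitive ...
≻-trans : ∀ {n} (k l m : ℤ) (x y z : Fin n) →
          (k at prim x) ≻ (l at prim y) → (l at prim y) ≻ (m at prim z) →
          (k at prim x) ≻ (m at prim z)
≻-trans k l m x y z h₁ h₂ with toℕ z ℕ.<? toℕ x
... | yes z<x = ≻-byIndex k m x z z<x
                  (ZP.≤-trans (≻⇒≥ l m (prim y) (prim z) h₂) (≻⇒≥ k l (prim x) (prim y) h₁))
... | no z≮x with toℕ x ℕ.≤? toℕ y
...   | yes x≤y = ≻-bySize k m (prim x) (prim z)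
                    (ZP.≤-<-trans (≻⇒≥ l m (prim y) (prim z) h₂) (≻⇒> k l x y h₁ x≤y))
...   | no x≰y  = ≻-bySize k m (prim x) (prim z)
                    (ZP.<-≤-trans (≻⇒> l m y z h₂ y≤z) (≻⇒≥ k l (prim x) (prim y) h₁))
  where
  y≤z : toℕ y ℕ.≤ toℕ z
  y≤z = NP.<⇒≤ (NP.<-≤-trans (NP.≰⇒> x≰y) (NP.≮⇒≥ z≮x))

≻-total : ∀ {n} (k l : ℤ) (x y : Fin n) →
          (k at prim x) ≻ (l at prim y) ⊎ (l at prim y) ⪰ (k at prim x)
≻-total k l x y with ZP.<-cmp l k
... | tri< l<k _ _ = inj₁ (≻-bySize k l (prim x) (prim y) l<k)
... | tri> _ _ k<l = inj₂ (inj₁ (≻-bySize l k (prim y) (prim x) k<l))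
... | tri≈ _ refl _ with NP.<-cmp (toℕ y) (toℕ x)
...   | tri< y<x _ _ = inj₁ (≻-byIndex l l x y y<x ZP.≤-refl)
...   | tri> _ _ x<y = inj₂ (inj₁ (≻-byIndex l l y x x<y ZP.≤-refl))
...   | tri≈ _ y≡x _ = inj₂ (inj₂ (cong (λ z → l at prim z) (FP.toℕ-injective y≡x)))

-- ≻ and ⪰ only see the difference of the sizes, so shifting both parts preserves them.
same-difference : ∀ (k l m : ℤ) → (k ℤ.+ m) - (l ℤ.+ m) ≡ k - l
same-difference = ZS.solve-∀

≻-shift : ∀ {n} (P Q : Part n) (m : ℤ) → P ≻ Q → (P +ₚ m) ≻ (Q +ₚ m)
≻-shift (k at x) (l at y) m = subst (χ (x ≤ᶜ y) ℤ.≤_) (sym (same-difference k l m))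

≻-unshift : ∀ {n} (P Q : Part n) (m : ℤ) → (P +ₚ m) ≻ (Q +ₚ m) → P ≻ Q
≻-unshift (k at x) (l at y) m = subst (χ (x ≤ᶜ y) ℤ.≤_) (same-difference k l m)

⪰-shift : ∀ {n} (P Q : Part n) (m : ℤ) → P ⪰ Q → (P +ₚ m) ⪰ (Q +ₚ m)
⪰-shift P Q m (inj₁ h)    = inj₁ (≻-shift P Q m h)
⪰-shift P Q m (inj₂ refl) = inj₂ refl

halfSize : ℕ → ℤ
halfSize zero          = + 0
halfSize (suc zero)    = + 0
halfSize (suc (suc k)) = halfSize k ℤ.+ + 1

halfColor : ∀ {n} → SecColor n → ℕ → Fin n
halfColor p zero          = i p
halfColor p (suc zero)    = j p
halfColor p (suc (suc k)) = halfColor p k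

halfSeq : ∀ {n} → SecColor n → ℕ → Part n
halfSeq p k = halfSize k at prim (halfColor p k)

data Parity : ℕ → Set where
  even : ∀ u → Parity (u ℕ.* 2)
  odd  : ∀ u → Parity (1 ℕ.+ u ℕ.* 2)

parity : ∀ k → Parity k
parity zero = even 0
parity (suc k) with parity k
... | even u = odd u
... | odd u  = even (suc u)

even-mod : ∀ u → u ℕ.* 2 ℕ.% 2 ≡ 0
even-mod u = m*n%n≡0 u 2

even-div : ∀ u → u ℕ.* 2 ℕ./ 2 ≡ u
even-div u = m*n/n≡m u 2

odd-mod : ∀ u → (1 ℕ.+ u ℕ.* 2) ℕ.% 2 ≡ 1
odd-mod u = [m+kn]%n≡m%n 1 u 2

odd-div : ∀ u → (1 ℕ.+ u ℕ.* 2) ℕ./ 2 ≡ u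
odd-div zero    = refl
odd-div (suc u) =
  trans (m/n≡1+[m∸n]/n {3 ℕ.+ u ℕ.* 2} {2} (s≤s (s≤s z≤n))) (cong suc (odd-div u))

module _ {n : ℕ} (p : SecColor n) where
  halfSeq-even : ∀ u → halfSeq p (u ℕ.* 2) ≡ (+ u) at prim (i p)
  halfSeq-even zero    = refl
  halfSeq-even (suc u) =
    trans (cong (_+ₚ + 1) (halfSeq-even u)) (cong (λ s → (+ s) at prim (i p)) (NP.+-comm u 1))

  halfSeq-odd : ∀ u → halfSeq p (1 ℕ.+ u ℕ.* 2) ≡ (+ u) at prim (j p)
  halfSeq-odd zero    = refl
  halfSeq-odd (suc u) =
    trans (cong (_+ₚ + 1) (halfSeq-odd u)) (cong (λ s → (+ s) at prim (j p)) (NP.+-comm u 1))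

  β≡halfSeq : ∀ k → β k p ≡ halfSeq p k
  β≡halfSeq k with parity k
  ... | even u rewrite even-mod u | even-div u = sym (halfSeq-even u)
  ... | odd u rewrite odd-mod u | odd-div u = sym (halfSeq-odd u)

  α≡halfSeq : ∀ k → α k p ≡ halfSeq p (suc k)
  α≡halfSeq k with parity k
  ... | even u rewrite even-mod u | even-div u = sym (halfSeq-odd u)
  ... | odd u rewrite odd-mod u | odd-div u =
    trans (cong (λ s → (+ s) at prim (i p)) (NP.+-comm u 1)) (sym (halfSeq-even (suc u)))

  halfSeq-step : ∀ k → halfSeq p (suc k) ≻ halfSeq p k
  halfSeq-step zero = ≻-byIndex (+ 0) (+ 0) (j p) (i p) (i<j p) ZP.≤-refl
  halfSeq-step (suc zero) = ≻-bySize (+ 1) (+ 0) (prim (i p)) (prim (j p)) (ℤ.+<+ (s≤s z≤n))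
  halfSeq-step (suc (suc k)) = ≻-shift (halfSeq p (suc k)) (halfSeq p k) (+ 1) (halfSeq-step k)

halfSeq-trans : ∀ {n} (r s t : SecColor n) (k l m : ℕ) →
                halfSeq r k ≻ halfSeq s l → halfSeq s l ≻ halfSeq t m → halfSeq r k ≻ halfSeq t m
halfSeq-trans r s t k l m =
  ≻-trans (halfSize k) (halfSize l) (halfSize m) (halfColor r k) (halfColor s l) (halfColor t m)

twoStep : ∀ {P : ℕ → Set} → P 0 → P 1 → (∀ k → P k → P (2 ℕ.+ k)) → ∀ k → P k
twoStep p₀ p₁ step zero          = p₀
twoStep p₀ p₁ step (suc zero)    = p₁
twoStep p₀ p₁ step (suc (suc k)) = step k (twoStep p₀ p₁ step k)

0<1 : + 0 ℤ.< + 1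
0<1 = ℤ.+<+ (s≤s z≤n)

module Comparison {n : ℕ} (p q : SecColor n) where

  C : ℕ → ℕ → Set
  C k l = halfSeq p k ≻ halfSeq q l

  C-shift : ∀ k l → C k l → C (2 ℕ.+ k) (2 ℕ.+ l)
  C-shift k l = ≻-shift (halfSeq p k) (halfSeq q l) (+ 1)

  C-unshift : ∀ k l → C (2 ℕ.+ k) (2 ℕ.+ l) → C k l
  C-unshift k l = ≻-unshift (halfSeq p k) (halfSeq q l) (+ 1)

  C-stepˡ : ∀ k l → C k l → C (suc k) l
  C-stepˡ k l = halfSeq-trans p p q (suc k) k l (halfSeq-step p k)

  C-stepʳ : ∀ k l → C k (suc l) → C k l
  C-stepʳ k l h = halfSeq-trans p q q k (suc l) l h (halfSeq-step q l)

  C-monoˡ : ∀ {k k'} l → k ℕ.≤ k' → C k l → C k' l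
  C-monoˡ {k} l le h = go (NP.≤⇒≤′ le)
    where
    go : ∀ {m} → k ≤′ m → C m l
    go ≤′-refl          = h
    go (≤′-step {m} le) = C-stepˡ m l (go le)

  C-byIndex : ∀ k l → halfSize l ℤ.≤ halfSize k →
              toℕ (halfColor q l) ℕ.< toℕ (halfColor p k) → C k l
  C-byIndex k l le lt =
    ≻-byIndex (halfSize k) (halfSize l) (halfColor p k) (halfColor q l) lt le

  ¬C-byIndex : ∀ k l → halfSize k ℤ.≤ halfSize l →
               toℕ (halfColor p k) ℕ.≤ toℕ (halfColor q l) → ¬ C k l
  ¬C-byIndex k l le ge h =
    ZP.<-irrefl refl
      (ZP.<-≤-trans (≻⇒> (halfSize k) (halfSize l) (halfColor p k) (halfColor q l) h ge) le)

  C-bySize : ∀ k l → halfSize l ℤ.< halfSize k → C k l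
  C-bySize k l = ≻-bySize (halfSize k) (halfSize l) (prim (halfColor p k)) (prim (halfColor q l))

  ¬C-bySize : ∀ k l → halfSize k ℤ.< halfSize l → ¬ C k l
  ¬C-bySize k l lt h =
    ZP.<-irrefl refl
      (ZP.<-≤-trans lt (≻⇒≥ (halfSize k) (halfSize l) (prim (halfColor p k)) (prim (halfColor q l)) h))

  a b c d : ℕ
  a = toℕ (i p)
  b = toℕ (j p)
  c = toℕ (i q)
  d = toℕ (j q)

  record Threshold (D : ℕ) : Set where
    field
      below : ∀ k l → 2 ℕ.+ k ≡ D ℕ.+ l → ¬ C k l
      edge  : ∀ k l → 1 ℕ.+ k ≡ D ℕ.+ l → C k l ⊎ C (1 ℕ.+ k) (1 ℕ.+ l)

  ¬C-twoAhead : ∀ k → ¬ C k (2 ℕ.+ k)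
  ¬C-twoAhead = twoStep (¬C-bySize 0 2 0<1) (¬C-bySize 1 3 0<1)
                        (λ k h → h ∘ C-unshift k (2 ℕ.+ k))

  threshold₀ : d ℕ.< a → Threshold 0
  threshold₀ d<a = record
    { below = λ k l e → subst (λ m → ¬ C k m) e (¬C-twoAhead k)
    ; edge  = λ k l e → subst (λ m → C k m ⊎ C (1 ℕ.+ k) (1 ℕ.+ m)) e (atOffsetOne k)
    }
    where
    C01 : C 0 1
    C01 = C-byIndex 0 1 ZP.≤-refl d<a
    atOffsetOne : ∀ k → C k (1 ℕ.+ k) ⊎ C (1 ℕ.+ k) (2 ℕ.+ k)
    atOffsetOne = twoStep (inj₁ C01) (inj₂ (C-shift 0 1 C01))
                          (λ k → map (C-shift k (1 ℕ.+ k)) (C-shift (1 ℕ.+ k) (2 ℕ.+ k)))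

  threshold₁ : a ℕ.≤ d → c ℕ.< a ⊎ d ℕ.< b → Threshold 1
  threshold₁ a≤d beats = record
    { below = λ k l e → subst (λ m → ¬ C k m) (NP.suc-injective e) (¬atOffsetOne k)
    ; edge  = λ k l e →
        subst (λ m → C k m ⊎ C (1 ℕ.+ k) (1 ℕ.+ m)) (NP.suc-injective e) (onDiagonal k)
    }
    where
    ¬atOffsetOne : ∀ k → ¬ C k (1 ℕ.+ k)
    ¬atOffsetOne = twoStep (¬C-byIndex 0 1 ZP.≤-refl a≤d) (¬C-bySize 1 2 0<1)
                           (λ k h → h ∘ C-unshift k (1 ℕ.+ k))
    C00⊎C11 : C 0 0 ⊎ C 1 1
    C00⊎C11 = map (C-byIndex 0 0 ZP.≤-refl) (C-byIndex 1 1 ZP.≤-refl) beats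
    C11⊎C22 : C 1 1 ⊎ C 2 2
    C11⊎C22 = [ (λ h → inj₂ (C-shift 0 0 h)) , inj₁ ]′ C00⊎C11
    onDiagonal : ∀ k → C k k ⊎ C (1 ℕ.+ k) (1 ℕ.+ k)
    onDiagonal = twoStep C00⊎C11 C11⊎C22
                         (λ k → map (C-shift k k) (C-shift (1 ℕ.+ k) (1 ℕ.+ k)))

  threshold₂ : a ℕ.≤ c → b ℕ.≤ d → Threshold 2
  threshold₂ a≤c b≤d = record
    { below = λ k l e →
        subst (λ m → ¬ C k m) (NP.suc-injective (NP.suc-injective e)) (¬onDiagonal k)
    ; edge  = λ k l e →
        subst (λ m → C m l ⊎ C (1 ℕ.+ m) (1 ℕ.+ l)) (sym (NP.suc-injective e)) (belowDiagonal l)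
    }
    where
    ¬onDiagonal : ∀ k → ¬ C k k
    ¬onDiagonal = twoStep (¬C-byIndex 0 0 ZP.≤-refl a≤c) (¬C-byIndex 1 1 ZP.≤-refl b≤d)
                          (λ k h → h ∘ C-unshift k k)
    C21 : C 2 1
    C21 = C-bySize 2 1 0<1
    belowDiagonal : ∀ l → C (1 ℕ.+ l) l ⊎ C (2 ℕ.+ l) (1 ℕ.+ l)
    belowDiagonal = twoStep (inj₂ C21) (inj₁ C21)
                            (λ l → map (C-shift (1 ℕ.+ l) l) (C-shift (2 ℕ.+ l) (1 ℕ.+ l)))

  module Consequences {D : ℕ} (T : Threshold D) where
    open Threshold T

    lower : ∀ {k l} → C k l → D ℕ.+ l ℕ.≤ suc k
    lower {k} {l} h with D ℕ.+ l ℕ.≤? suc k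
    ... | yes le = le
    ... | no gt with NP.m≤n⇒∃[o]m+o≡n (NP.≰⇒> gt)
    ...   | o , e = ⊥-elim (below (k ℕ.+ o) l e (C-monoˡ l (NP.m≤m+n k o) h))

    upper : ∀ {k l} → D ℕ.+ suc l ℕ.≤ k → C k (suc l)
    upper {k} {l} le =
      [ C-monoˡ (suc l) (NP.<⇒≤ le′)
      , (λ h → C-monoˡ (suc l) le′ (C-stepʳ (suc (D ℕ.+ l)) (suc l) h))
      ]′ (edge (D ℕ.+ l) (suc l) (sym (NP.+-suc D l)))
      where
      le′ : suc (D ℕ.+ l) ℕ.≤ k
      le′ = subst (ℕ._≤ k) (NP.+-suc D l) le

    ββ-lower : ∀ k l → β k p ≻ β l q → D ℕ.+ l ℕ.≤ suc k
    ββ-lower k l h rewrite β≡halfSeq p k | β≡halfSeq q l = lower h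

    βα-witness : Σ ℕ (λ k → Σ ℕ (λ l →
                   2 ℕ.≤ k × 2 ℕ.≤ l × β k p ≻ α l q × + D ≡ + k - + l))
    βα-witness with edge (2 ℕ.+ D) 3 (sym (NP.+-comm D 3))
    ... | inj₁ h = 2 ℕ.+ D , 2 , NP.m≤m+n 2 D , NP.≤-refl ,
                   subst₂ _≻_ (sym (β≡halfSeq p (2 ℕ.+ D))) (sym (α≡halfSeq q 2)) h , refl
    ... | inj₂ h = 3 ℕ.+ D , 3 , NP.m≤m+n 2 (suc D) , NP.n≤1+n 2 ,
                   subst₂ _≻_ (sym (β≡halfSeq p (3 ℕ.+ D))) (sym (α≡halfSeq q 3)) h , refl

    βα-lower : ∀ k l → β k p ≻ α l q → D ℕ.+ l ℕ.≤ k
    βα-lower k l h rewrite β≡halfSeq p k | α≡halfSeq q l =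
      NP.≤-pred (subst (ℕ._≤ suc k) (NP.+-suc D l) (lower h))

    βα-minimum : IsMinβα p q (+ D)
    βα-minimum = βα-witness , λ k l _ _ h → ℕ-minus← (βα-lower k l h)

    βα-upper : ∀ k l → suc D ℕ.+ l ℕ.≤ k → β k p ≻ α l q
    βα-upper k l le rewrite β≡halfSeq p k | α≡halfSeq q l =
      upper (subst (ℕ._≤ k) (sym (NP.+-suc D l)) le)

    β-edge : ∀ k l → D ℕ.+ l ≡ k → (β l q +ₚ + 1) ⪰ β k p
    β-edge .(D ℕ.+ l) l refl rewrite β≡halfSeq p (D ℕ.+ l) | β≡halfSeq q l
      with ≻-total (halfSize (D ℕ.+ l)) (halfSize (2 ℕ.+ l))
                   (halfColor p (D ℕ.+ l)) (halfColor q (2 ℕ.+ l))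
    ... | inj₂ ge = ge
    ... | inj₁ h  =
      ⊥-elim (NP.<-irrefl refl (NP.≤-pred (subst (ℕ._≤ suc (D ℕ.+ l)) twoMore (lower h))))
      where
      twoMore : D ℕ.+ (2 ℕ.+ l) ≡ 2 ℕ.+ (D ℕ.+ l)
      twoMore = trans (NP.+-suc D (suc l)) (cong suc (NP.+-suc D l))

    βα-or-chain : ∀ k l → 2 ℕ.≤ k → D ℕ.+ l ℕ.≤ k →
      β k p ≻ α l q
      ⊎ ((α l q +ₚ + 1) ≫ α (k ℕ.∸ 1) p
         × α (k ℕ.∸ 1) p ≻ β (k ℕ.∸ 1) p
         × β (k ℕ.∸ 1) p ≻ β l q)
    βα-or-chain (suc k) l _ le with NP.m≤n⇒m<n∨m≡n le
    ... | inj₁ lt = inj₁ (βα-upper (suc k) l lt)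
    ... | inj₂ e
      rewrite β≡halfSeq p (suc k) | α≡halfSeq q l | α≡halfSeq p k | β≡halfSeq p k | β≡halfSeq q l
      with edge k l (sym e)
    ...   | inj₂ h = inj₁ h
    ...   | inj₁ h
      with ≻-total (halfSize (suc k)) (halfSize (suc l)) (halfColor p (suc k)) (halfColor q (suc l))
    ...     | inj₁ h′ = inj₁ h′
    ...     | inj₂ ge =
      inj₂ (⪰-shift (halfSeq q (suc l)) (halfSeq p (suc k)) (+ 1) ge , halfSeq-step p k , h)

  -- The relative position of the index pairs (a, b) and (c, d), indexed by the value D
  -- that Δ(p, q) will take.
  data Position : ℕ → Set where
    apart         : d ℕ.< a → Position 0
    crossingBelow : c ℕ.< a → a ℕ.≤ d → Position 1
    nested        : a ℕ.< c → d ℕ.< b → Position 1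
    sharedShorter : a ≡ c → d ℕ.< b → Position 1
    crossingAbove : a ℕ.< c → b ℕ.≤ d → Position 2
    sharedLonger  : a ≡ c → b ℕ.≤ d → Position 2

  position : Σ ℕ Position
  position with d ℕ.<? a
  ... | yes d<a = 0 , apart d<a
  ... | no d≮a with NP.<-cmp c a | d ℕ.<? b
  ...   | tri< c<a _ _ | _       = 1 , crossingBelow c<a (NP.≮⇒≥ d≮a)
  ...   | tri> _ _ a<c | yes d<b = 1 , nested a<c d<b
  ...   | tri> _ _ a<c | no d≮b  = 2 , crossingAbove a<c (NP.≮⇒≥ d≮b)
  ...   | tri≈ _ c≡a _ | yes d<b = 1 , sharedShorter (sym c≡a) d<b
  ...   | tri≈ _ c≡a _ | no d≮b  = 2 , sharedLonger (sym c≡a) (NP.≮⇒≥ d≮b)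

  threshold : ∀ {D} → Position D → Threshold D
  threshold (apart d<a)             = threshold₀ d<a
  threshold (crossingBelow c<a a≤d) = threshold₁ a≤d (inj₁ c<a)
  threshold (nested a<c d<b)        = threshold₁ (NP.<⇒≤ (NP.<-trans a<c (i<j q))) (inj₂ d<b)
  threshold (sharedShorter a≡c d<b) =
    threshold₁ (NP.<⇒≤ (subst (ℕ._< d) (sym a≡c) (i<j q))) (inj₂ d<b)
  threshold (crossingAbove a<c b≤d) = threshold₂ (NP.<⇒≤ a<c) b≤d
  threshold (sharedLonger a≡c b≤d)  = threshold₂ (NP.≤-reflexive a≡c) b≤d

  data ≫Requirement (D : ℕ) : Set where
    special  : Special p q → χ (sec p ≤ᶜ sec q) ≡ + D → ≫Requirement D
    ordinary : ¬ Special p q → χ (sec p ≤ᶜ sec q) ℤ.+ + 1 ≡ + D → ≫Requirement D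

  requirement : ∀ {D} → Position D → ≫Requirement D
  requirement (apart d<a) =
    special (inj₁ (i<j q , d<a , i<j p)) (cong χ (Lex.lex-> a c b d (NP.<-trans (i<j q) d<a)))
  requirement (crossingBelow c<a a≤d) =
    ordinary (λ { (inj₁ (_ , d<a , _)) → NP.<⇒≱ d<a a≤d ; (inj₂ (a<c , _)) → NP.<-asym c<a a<c })
             (cong (λ x → χ x ℤ.+ + 1) (Lex.lex-> a c b d c<a))
  requirement (nested a<c d<b) =
    special (inj₂ (a<c , i<j q , d<b)) (cong χ (Lex.lex-< a c b d a<c))
  requirement (sharedShorter a≡c d<b) =
    ordinary (λ { (inj₁ (_ , d<a , _)) → NP.<-asym d<a (subst (ℕ._< d) (sym a≡c) (i<j q))
                ; (inj₂ (a<c , _)) → NP.<-irrefl a≡c a<c })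
             (cong (λ x → χ x ℤ.+ + 1) (Lex.lex-≡-> a c b d a≡c d<b))
  requirement (crossingAbove a<c b≤d) =
    ordinary (λ { (inj₁ (_ , d<a , _)) → NP.<-asym d<a (NP.<-trans a<c (i<j q))
                ; (inj₂ (_ , _ , d<b)) → NP.<⇒≱ d<b b≤d })
             (cong (λ x → χ x ℤ.+ + 1) (Lex.lex-< a c b d a<c))
  requirement (sharedLonger a≡c b≤d) =
    ordinary (λ { (inj₁ (_ , d<a , _)) → NP.<-asym d<a (subst (ℕ._< d) (sym a≡c) (i<j q))
                ; (inj₂ (a<c , _)) → NP.<-irrefl a≡c a<c })
             (cong (λ x → χ x ℤ.+ + 1) (Lex.lex-≡-≤ a c b d a≡c b≤d))

  absorb-one : ∀ {D} L → χ (sec p ≤ᶜ sec q) ℤ.+ + 1 ≡ + D →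
               χ (sec p ≤ᶜ sec q) ℤ.+ (L ℤ.+ + 1) ≡ + D ℤ.+ L
  absorb-one L e = trans (regroup (χ (sec p ≤ᶜ sec q)) L) (cong (ℤ._+ L) e)

  ≫⇒≥ : ∀ {D} → ≫Requirement D → ∀ K L → (K at sec p) ≫ (L at sec q) → + D ℤ.≤ K - L
  ≫⇒≥ (special s e)  K L h = subst (ℤ._≤ K - L) e (proj₁ h s)
  ≫⇒≥ (ordinary s e) K L h =
    ≤-minus← {m' = L} (subst (ℤ._≤ K) (absorb-one L e) (≤-minus→ {m' = L ℤ.+ + 1} (proj₂ h s)))

  ≥⇒≫ : ∀ {D} → ≫Requirement D → ∀ K L → + D ℤ.≤ K - L → (K at sec p) ≫ (L at sec q)
  ≥⇒≫ (special s e) K L h = (λ _ → subst (ℤ._≤ K - L) (sym e) h) , (λ ns → ⊥-elim (ns s))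
  ≥⇒≫ (ordinary s e) K L h =
    (λ sp → ⊥-elim (s sp)) ,
    (λ _ → ≤-minus← {m' = L ℤ.+ + 1} (subst (ℤ._≤ K) (sym (absorb-one L e)) (≤-minus→ {m' = L} h)))

  isΔ : ∀ {D} → Position D → IsΔ p q (+ D)
  isΔ {D} pos K =
    ≥⇒≫ (requirement pos) K (K - + D) (ZP.≤-reflexive (sym (K-[K-d] K (+ D)))) ,
    λ d′ h → subst (+ D ℤ.≤_) (K-[K-d] K d′) (≫⇒≥ (requirement pos) K (K - d′) h)

  Δ-unique : ∀ {D} → Position D → ∀ d → IsΔ p q d → d ≡ + D
  Δ-unique {D} pos d isΔd =
    ZP.≤-antisym (proj₂ (isΔd (+ 0)) (+ D) (proj₁ (isΔ pos (+ 0))))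
                 (proj₂ (isΔ pos (+ 0)) d (proj₁ (isΔd (+ 0))))

  ββ⇒≫ : ∀ {D} → Position D → ∀ k l → β k p ≻ β l q → secPart (suc k) p ≫ secPart l q
  ββ⇒≫ pos k l h = ≥⇒≫ (requirement pos) (+ suc k) (+ l) (ℕ-minus← (ββ-lower k l h))
    where open Consequences (threshold pos)

lemma2p2 : ∀ {n : ℕ} (p q : SecColor n) →
    Σ ℤ (IsΔ p q)
    × (∀ (k l : ℕ) → 2 ℕ.≤ k → 2 ℕ.≤ l →
    β k p ≻ β l q → secPart (ℕ.suc k) p ≫ secPart l q)
    × (∀ (d : ℤ) → IsΔ p q d →
    IsMinβα p q d
    × (∀ (k l : ℕ) → 2 ℕ.≤ k → 2 ℕ.≤ l → d ℤ.≤ + k - + l →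
    (β k p ≻ α l q
    ⊎ ((α l q +ₚ + 1) ≫ α (k ℕ.∸ 1) p
    × α (k ℕ.∸ 1) p ≻ β (k ℕ.∸ 1) p
    × β (k ℕ.∸ 1) p ≻ β l q))
    × (+ k - + l ≡ d → (β l q +ₚ + 1) ⪰ β k p)
    × (d ℤ.< + k - + l → β k p ≻ α l q)))
lemma2p2 p q with Comparison.position p q
... | D , pos =
  (+ D , isΔ pos) ,
  (λ k l _ _ → ββ⇒≫ pos k l) ,
  λ d isΔd → let d≡D = Δ-unique pos d isΔd in
    subst (IsMinβα p q) (sym d≡D) βα-minimum ,
    λ k l 2≤k _ le →
      βα-or-chain k l 2≤k (ℕ-minus→ (subst (ℤ._≤ + k - + l) d≡D le)) ,
      (λ e → β-edge k l (ℕ-minus-≡ (trans e d≡D))) ,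
      (λ lt → βα-upper k l (ℕ-minus-< (subst (ℤ._< + k - + l) d≡D lt)))
  where
  open Comparison p q
  open Consequences (threshold pos)
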